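{- Let $S_1,S_2\subseteq\mathbb N$ be numerical semigroups, $S=S_1\times S_2\subseteq\mathbb N^2$, and $\boldsymbol\omega=(w_1,w_2)\in S$ with $w_1,w_2>0$. Write $\mathrm{Ap}(S_1,w_1)=\{u_1<u_2<\dots<u_{w_1}\}$ and $\mathrm{Ap}(S_2,w_2)=\{v_1<\dots<v_{w_2}\}$, and set formally $u_{w_1+1}=v_{w_2+1}=\infty$. Let $\mathrm{Ap}(S,\boldsymbol\omega)=\bigcup_kA_k$ be the partition into levels. Then $A_1=\{(0,0)\}$, and for every $k\ge2$ the level $A_k$ equals the union, over all pairs $(i,j)$ with $1\le i\le w_1$, $1\le j\le w_2$, $i+j=k$, of the sets $$\{(u_i,b):b\in S_2,\ v_j<b\le v_{j+1}\}\cup\{(a,v_j):a\in S_1,\ u_i<a\le u_{i+1}\}.$$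
   Context: For a semigroup $T$ and $\boldsymbol\omega\in T$, $\mathrm{Ap}(T,\boldsymbol\omega)=T\setminus(\boldsymbol\omega+T)$. Notation: for $\boldsymbol\alpha,\boldsymbol\beta\in\mathbb Z^2$, $\le$ is componentwise, $\boldsymbol\alpha\ll\boldsymbol\beta$ means strict inequality in both coordinates, $\wedge$ is the componentwise minimum. For $i\in\{1,2\}$: $\Delta^S_i(\boldsymbol\alpha)=\{\boldsymbol\beta\in S:\beta_i=\alpha_i,\ \beta_j>\alpha_j\ (j\ne i)\}$. An element $\boldsymbol\alpha\in S$ is a complete infimum of $\boldsymbol\beta,\boldsymbol\beta'$ if $\boldsymbol\beta\in\Delta^S_1(\boldsymbol\alpha)$ and $\boldsymbol\beta'\in\Delta^S_2(\boldsymbol\alpha)$ (or vice versa). Levels of $A=S\setminus E$ ($E=\boldsymbol\omega+S$): $B^{(1)}$ is the set of $\boldsymbol\alpha\in A$ such that no $\boldsymbol\beta\in A$ satisfies $\boldsymbol\alpha\ll\boldsymbol\beta$; $C^{(1)}$ the set of elements of $B^{(1)}$ that are complete infima of two elements of $B^{(1)}$; $D^{(1)}=B^{(1)}\setminus C^{(1)}$; inductively $B^{(i)},C^{(i)},D^{(i)}$ are defined in the same way inside $A\setminus\bigcup_{j<i}D^{(j)}$. There is $N$ with $A=D^{(1)}\sqcup\dots\sqcup D^{(N)}$; the levels are $A_i=D^{(N+1-i)}$. -}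

module Defs where

open import Data.Nat using (ℕ; zero; suc; _+_; _∸_; _≤_; _<_)
open import Data.Product using (Σ; ∃; _×_; _,_; proj₁; proj₂)
open import Data.Sum using (_⊎_)
open import Relation.Nullary using (¬_)
open import Relation.Binary.PropositionalEquality using (_≡_)

Pred₁ : Set₁
Pred₁ = ℕ → Set

ℕ² : Set
ℕ² = ℕ × ℕ

Pred₂ : Set₁
Pred₂ = ℕ² → Set

record IsNumericalSemigroup (S : Pred₁) : Set where
  field
    zero∈ : S 0
    +-closed : ∀ {a b} → S a → S b → S (a + b)
    cofinite : ∃ λ F → ∀ n → F ≤ n → S n

Ap₁ : Pred₁ → ℕ → Pred₁
Ap₁ S w x = S x × ¬ (∃ λ y → S y × x ≡ w + y)

_⊗_ : Pred₁ → Pred₁ → Pred₂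
(S₁ ⊗ S₂) (a , b) = S₁ a × S₂ b

_+²_ : ℕ² → ℕ² → ℕ²
(a , b) +² (c , d) = (a + c , b + d)

Ap₂ : Pred₂ → ℕ² → Pred₂
Ap₂ S ω α = S α × ¬ (∃ λ γ → S γ × α ≡ ω +² γ)

_≪_ : ℕ² → ℕ² → Set
(a₁ , a₂) ≪ (b₁ , b₂) = (a₁ < b₁) × (a₂ < b₂)

-- β ∈ Δ₁(α) (membership in S is checked separately) : β₁ = α₁, β₂ > α₂
Δ₁ : ℕ² → ℕ² → Set
Δ₁ (a₁ , a₂) (b₁ , b₂) = (b₁ ≡ a₁) × (a₂ < b₂)

Δ₂ : ℕ² → ℕ² → Set
Δ₂ (a₁ , a₂) (b₁ , b₂) = (b₂ ≡ a₂) × (a₁ < b₁)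

Bset : Pred₂ → Pred₂
Bset R α = R α × ¬ (∃ λ β → R β × α ≪ β)

Cset : Pred₂ → Pred₂
Cset R α = Bset R α ×
  (∃ λ β → ∃ λ β' → Bset R β × Bset R β' ×
     ((Δ₁ α β × Δ₂ α β') ⊎ (Δ₂ α β × Δ₁ α β')))

Dset : Pred₂ → Pred₂
Dset R α = Bset R α × ¬ Cset R α

-- Rem A i = A ∖ (D⁽¹⁾ ∪ … ∪ D⁽ⁱ⁾)   (0-based: Rem A 0 = A)
Rem : Pred₂ → ℕ → Pred₂
Rem A zero α = A α
Rem A (suc i) α = Rem A i α × ¬ Dset (Rem A i) α

-- D⁽ⁱ⁺¹⁾ of the paper is DD A i
DD : Pred₂ → ℕ → Pred₂
DD A i = Dset (Rem A i)

IsLevelCount : Pred₂ → ℕ → Set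
IsLevelCount A N =
  (∀ α → A α → ∃ λ j → (j < N) × DD A j α) × (1 ≤ N) × (∃ λ α → DD A (N ∸ 1) α)

-- The k-th level A_k = D⁽ᴺ⁺¹⁻ᵏ⁾ (empty when k = 0 or k > N)
Level : Pred₂ → ℕ → ℕ → Pred₂
Level A N k α = (1 ≤ k) × (k ≤ N) × DD A (N ∸ k) α

-- "b ≤ u_i", where u_i = ∞ for i > w
≤∞ : ℕ → (ℕ → ℕ) → ℕ → ℕ → Set
≤∞ w u i b = i ≤ w → b ≤ u i

Enumerates : Pred₁ → ℕ → (ℕ → ℕ) → Set
Enumerates X w u =
  (∀ i j → 1 ≤ i → i < j → j ≤ w → u i < u j) ×
  (∀ x → (X x → ∃ λ i → (1 ≤ i) × (i ≤ w) × (u i ≡ x)) ×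
         ((∃ λ i → (1 ≤ i) × (i ≤ w) × (u i ≡ x)) → X x))

RHS : Pred₁ → Pred₁ → ℕ → ℕ → (ℕ → ℕ) → (ℕ → ℕ) → ℕ → Pred₂
RHS S₁ S₂ w₁ w₂ u v k (a , b) =
  ∃ λ i → ∃ λ j → (1 ≤ i) × (i ≤ w₁) × (1 ≤ j) × (j ≤ w₂) × (i + j ≡ k) ×
    ( (a ≡ u i × S₂ b × v j < b × ≤∞ w₂ v (suc j) b)
    ⊎ (b ≡ v j × S₁ a × u i < a × ≤∞ w₁ u (suc i) a))

-- Let r₁ a be the number of u_i below a, r₂ b the number of v_j below b, and
-- λ (a , b) = 1 + r₁ a + r₂ b, which ranges over 1 … w₁ + w₂ on Ap(S, ω); the levels are
-- exactly the fibres of λ.  One coordinate of an element of Ap(S, ω) is an Apéry element of its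
-- factor, and the rank of that coordinate jumps as soon as it is exceeded.  Hence λ increases
-- strictly along ≪, and towards at least one partner of a complete infimum, so in every peeled
-- set the elements of maximal λ are exactly the ones removed.  Conversely an element of smaller λ
-- lies ≪-below the element obtained by moving both coordinates to the next u_i resp. v_j (or
-- adding w₁ resp. w₂ past the last one), or, when that overshoots, it is the complete infimum of
-- the two one-coordinate moves.  Finally λ (a , b) = i + j exactly on the sets of the statement.

module Submission where

open import Defs
open import Data.Nat using (ℕ; zero; suc; pred; _+_; _∸_; _≤_; _<_; z≤n; s≤s)
open import Data.Nat.Properties
open import Data.Product using (∃; _×_; _,_; proj₁; proj₂)
open import Data.Sum using (_⊎_; inj₁; inj₂)
import Data.Sum as Sum
open import Data.Empty using (⊥; ⊥-elim)
open import Function.Base using (_∘_)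
open import Function.Bundles using (_⇔_; mk⇔; Equivalence)
open import Function.Properties.Equivalence using () renaming (trans to ⇔-trans)
open import Relation.Nullary using (¬_; Dec; yes; no; contradiction)
import Relation.Nullary.Decidable as Dec
open import Relation.Unary using (_⊆_; _≐_)
open import Relation.Unary.Properties using (≐-sym)
open import Relation.Binary.PropositionalEquality using (_≡_; refl; sym; trans; cong; cong₂; subst)

open Equivalence using (to; from)

module Rank (w : ℕ) (u : ℕ → ℕ)
            (u-increasing : ∀ i j → 1 ≤ i → i < j → j ≤ w → u i < u j) where

  u-mono : ∀ {i j} → 1 ≤ i → i ≤ j → j ≤ w → u i ≤ u j
  u-mono {i} {j} 1≤i i≤j j≤w with m≤n⇒m<n∨m≡n i≤j
  ... | inj₁ i<j  = <⇒≤ (u-increasing i j 1≤i i<j j≤w)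
  ... | inj₂ refl = ≤-refl

  Image : ℕ → Set
  Image x = ∃ λ i → (1 ≤ i) × (i ≤ w) × (u i ≡ x)

  -- rank a is the number of indices i ≤ w with u i < a; since u is increasing,
  -- this is the largest such index, which is what rankUpTo searches for.
  rankUpTo : ℕ → ℕ → ℕ
  rankUpTo a zero = zero
  rankUpTo a (suc n) with u (suc n) <? a
  ... | yes _ = suc n
  ... | no _  = rankUpTo a n

  rankUpTo-≤ : ∀ a n → rankUpTo a n ≤ n
  rankUpTo-≤ a zero = z≤n
  rankUpTo-≤ a (suc n) with u (suc n) <? a
  ... | yes _ = ≤-refl
  ... | no _  = m≤n⇒m≤1+n (rankUpTo-≤ a n)

  ≤rankUpTo⇔ : ∀ a n → n ≤ w → ∀ {i} → 1 ≤ i → i ≤ n → (i ≤ rankUpTo a n ⇔ u i < a)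
  ≤rankUpTo⇔ a zero _ (s≤s _) ()
  ≤rankUpTo⇔ a (suc n) sn≤w {i} 1≤i i≤sn with u (suc n) <? a
  ... | yes un<a = mk⇔ (λ _ → ≤-<-trans (u-mono 1≤i i≤sn sn≤w) un<a) (λ _ → i≤sn)
  ... | no un≮a with m≤n⇒m<n∨m≡n i≤sn
  ...   | inj₁ i<sn = ≤rankUpTo⇔ a n (<⇒≤ sn≤w) 1≤i (≤-pred i<sn)
  ...   | inj₂ refl = mk⇔ (λ sn≤r → contradiction (≤-trans sn≤r (rankUpTo-≤ a n)) 1+n≰n)
                          (λ un<a → contradiction un<a un≮a)

  rank : ℕ → ℕ
  rank a = rankUpTo a w

  rank-≤ : ∀ a → rank a ≤ w
  rank-≤ a = rankUpTo-≤ a w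

  ≤rank⇒u< : ∀ {a i} → 1 ≤ i → i ≤ rank a → u i < a
  ≤rank⇒u< {a} 1≤i i≤r = to (≤rankUpTo⇔ a w ≤-refl 1≤i (≤-trans i≤r (rank-≤ a))) i≤r

  u<⇒≤rank : ∀ {a i} → 1 ≤ i → i ≤ w → u i < a → i ≤ rank a
  u<⇒≤rank {a} 1≤i i≤w = from (≤rankUpTo⇔ a w ≤-refl 1≤i i≤w)

  rank-mono : ∀ {a a'} → a ≤ a' → rank a ≤ rank a'
  rank-mono {a} a≤a' with rank a in eq
  ... | zero  = z≤n
  ... | suc r = u<⇒≤rank (s≤s z≤n) (subst (_≤ w) eq (rank-≤ a))
                  (<-≤-trans (≤rank⇒u< (s≤s z≤n) (≤-reflexive (sym eq))) a≤a')

  rank-0 : rank 0 ≡ 0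
  rank-0 = n≤0⇒n≡0 (≮⇒≥ λ 1≤r → n≮0 (≤rank⇒u< 1≤r ≤-refl))

  rank≡⇔ : ∀ {b j} → 1 ≤ j → j ≤ w → (rank b ≡ j ⇔ (u j < b × ≤∞ w u (suc j) b))
  rank≡⇔ {b} {j} 1≤j j≤w = mk⇔ slot exact
    where
      slot : rank b ≡ j → u j < b × ≤∞ w u (suc j) b
      slot refl = ≤rank⇒u< 1≤j ≤-refl , λ sj≤w → ≮⇒≥ λ u<b → 1+n≰n (u<⇒≤rank (s≤s z≤n) sj≤w u<b)
      exact : u j < b × ≤∞ w u (suc j) b → rank b ≡ j
      exact (u<b , b≤u) = ≤-antisym
        (≮⇒≥ λ j<r → <-irrefl refl (<-≤-trans (≤rank⇒u< (s≤s z≤n) j<r) (b≤u (≤-trans j<r (rank-≤ b)))))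
        (u<⇒≤rank 1≤j j≤w u<b)

  suc-rank-u : ∀ {i} → 1 ≤ i → i ≤ w → suc (rank (u i)) ≡ i
  suc-rank-u {suc zero} _ _ = cong suc (n≤0⇒n≡0 (≮⇒≥ λ 1≤r → <-irrefl refl (≤rank⇒u< (s≤s z≤n) 1≤r)))
  suc-rank-u {suc (suc i)} _ i≤w =
    cong suc (from (rank≡⇔ (s≤s z≤n) (<⇒≤ i≤w))
                 (u-increasing _ _ (s≤s z≤n) ≤-refl i≤w , λ _ → ≤-refl))

  image⇒index : ∀ {a} → Image a → suc (rank a) ≤ w × u (suc (rank a)) ≡ a
  image⇒index (i , 1≤i , i≤w , refl) rewrite suc-rank-u 1≤i i≤w = i≤w , refl

  image? : ∀ a → Dec (Image a)
  image? a with suc (rank a) ≤? w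
  ... | no sr≰w = no λ im → sr≰w (proj₁ (image⇒index im))
  ... | yes sr≤w with u (suc (rank a)) ≟ a
  ...   | yes eq = yes (suc (rank a) , s≤s z≤n , sr≤w , eq)
  ...   | no neq = no λ im → neq (proj₂ (image⇒index im))

  image⇒suc-rank≤ : ∀ {a a'} → Image a → a < a' → suc (rank a) ≤ rank a'
  image⇒suc-rank≤ (i , 1≤i , i≤w , refl) u<a' rewrite suc-rank-u 1≤i i≤w = u<⇒≤rank 1≤i i≤w u<a'

  rank-suc : ∀ a → rank (suc a) ≡ rank a ⊎ (Image a × rank (suc a) ≡ suc (rank a))
  rank-suc a with image? a
  ... | yes im = inj₂ (im , from (rank≡⇔ (s≤s z≤n) sr≤w) (s≤s (≤-reflexive eq) , above))
    where
      sr≤w = proj₁ (image⇒index im)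
      eq   = proj₂ (image⇒index im)
      above : ≤∞ w u (suc (suc (rank a))) (suc a)
      above ssr≤w = subst (_< u (suc (suc (rank a)))) eq (u-increasing _ _ (s≤s z≤n) ≤-refl ssr≤w)
  ... | no ¬im = inj₁ (≤-antisym (≮⇒≥ hit) (rank-mono (n≤1+n a)))
    where
      hit : ¬ rank a < rank (suc a)
      hit r<r' = ¬im (suc (rank a) , s≤s z≤n , sr≤w ,
                      ≤-antisym (≤-pred (≤rank⇒u< (s≤s z≤n) r<r'))
                                (≮⇒≥ λ u<a → 1+n≰n (u<⇒≤rank (s≤s z≤n) sr≤w u<a)))
        where sr≤w = ≤-trans r<r' (rank-≤ (suc a))

module ApéryRank (S : Pred₁) (S-ns : IsNumericalSemigroup S) {w : ℕ} (0<w : 0 < w) (w∈S : S w)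
                 (u : ℕ → ℕ) (u-enum : Enumerates (Ap₁ S w) w u) where

  open IsNumericalSemigroup S-ns
  open Rank w u (proj₁ u-enum) public

  image⇔ap : ∀ {x} → Image x ⇔ Ap₁ S w x
  image⇔ap {x} = mk⇔ (proj₂ (proj₂ u-enum x)) (proj₁ (proj₂ u-enum x))

  ap? : ∀ a → Dec (Ap₁ S w a)
  ap? a = Dec.map image⇔ap (image? a)

  image⇒∈S : ∀ {x} → Image x → S x
  image⇒∈S im = proj₁ (to image⇔ap im)

  image-0 : Image 0
  image-0 = from image⇔ap (zero∈ , λ { (y , _ , 0≡w+y) → <⇒≢ (≤-trans 0<w (m≤m+n w y)) 0≡w+y })

  u-1≡0 : u 1 ≡ 0
  u-1≡0 with image-0
  ... | (i , 1≤i , i≤w , uᵢ≡0) = n≤0⇒n≡0 (subst (u 1 ≤_) uᵢ≡0 (u-mono ≤-refl 1≤i i≤w))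

  rank≡0⇒≡0 : ∀ {a} → rank a ≡ 0 → a ≡ 0
  rank≡0⇒≡0 {a} r≡0 = n≤0⇒n≡0 (≮⇒≥ λ 0<a →
    1+n≰n (subst (1 ≤_) r≡0 (u<⇒≤rank ≤-refl 0<w (subst (_< a) (sym u-1≡0) 0<a))))

  -- The next element above a that can raise the rank: u_{t+1} for t = rank (suc a),
  -- or a + w once every u_i ≤ a.
  next-element : ∀ {a} → S a →
    ∃ λ a⁺ → S a⁺ × a < a⁺ × (Image a⁺ ⊎ rank a⁺ ≡ w) × rank a⁺ ≡ rank (suc a)
  next-element {a} a∈S with suc (rank (suc a)) ≤? w
  ... | yes st≤w = u (suc t) , image⇒∈S im , a<u , inj₁ im , suc-injective (suc-rank-u (s≤s z≤n) st≤w)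
    where
      t  = rank (suc a)
      im : Image (u (suc t))
      im = suc t , s≤s z≤n , st≤w , refl
      a<u : a < u (suc t)
      a<u = ≮⇒≥ λ u<sa → 1+n≰n (u<⇒≤rank (s≤s z≤n) st≤w u<sa)
  ... | no st≰w = a + w , +-closed a∈S w∈S , m<m+n a 0<w , inj₂ rank≡w , trans rank≡w (sym t≡w)
    where
      t≡w : rank (suc a) ≡ w
      t≡w = ≤-antisym (rank-≤ (suc a)) (≤-pred (≰⇒> st≰w))
      rank≡w : rank (a + w) ≡ w
      rank≡w = ≤-antisym (rank-≤ (a + w)) (subst (_≤ rank (a + w)) t≡w (rank-mono (m<m+n a 0<w)))

Bset-resp-≐ : ∀ {P Q} → P ≐ Q → Bset P ⊆ Bset Q
Bset-resp-≐ (P⊆Q , Q⊆P) (α∈P , ¬above) = P⊆Q α∈P , λ (β , β∈Q , α≪β) → ¬above (β , Q⊆P β∈Q , α≪β)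

Cset-resp-≐ : ∀ {P Q} → P ≐ Q → Cset P ⊆ Cset Q
Cset-resp-≐ P≐Q (α∈B , β , β' , β∈B , β'∈B , Δ) =
  Bset-resp-≐ P≐Q α∈B , β , β' , Bset-resp-≐ P≐Q β∈B , Bset-resp-≐ P≐Q β'∈B , Δ

Dset-resp-≐ : ∀ {P Q} → P ≐ Q → Dset P ⊆ Dset Q
Dset-resp-≐ P≐Q (α∈B , α∉C) = Bset-resp-≐ P≐Q α∈B , α∉C ∘ Cset-resp-≐ (≐-sym P≐Q)

Dset-cong : ∀ {P Q α} → P ≐ Q → Dset P α ⇔ Dset Q α
Dset-cong P≐Q = mk⇔ (Dset-resp-≐ P≐Q) (Dset-resp-≐ (≐-sym P≐Q))

module Levels (A : Pred₂) (lev : ℕ² → ℕ) (top : ℕ)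
  (lev-pos : ∀ α → 1 ≤ lev α)
  (lev-≤top : ∀ {α} → A α → lev α ≤ top)
  (lev-strict : ∀ {α β} → A α → α ≪ β → lev α < lev β)
  (lev-split : ∀ {α β β'} → A α → Δ₁ α β → Δ₂ α β' → lev α < lev β ⊎ lev α < lev β')
  (lev-fill : ∀ {α M} → A α → lev α < M → M ≤ top →
     (∃ λ β → A β × α ≪ β × lev β ≤ M) ⊎
     (∃ λ β → ∃ λ β' → (A β × lev β ≡ M) × (A β' × lev β' ≡ M) × Δ₁ α β × Δ₂ α β'))
  where

  Below : ℕ → Pred₂
  Below M α = A α × lev α ≤ M

  Fibre : ℕ → Pred₂
  Fibre M α = A α × lev α ≡ M

  fibre⊆B : ∀ {M} → Fibre M ⊆ Bset (Below M)
  fibre⊆B (α∈A , refl) = (α∈A , ≤-refl) , λ (β , (_ , levβ≤) , α≪β) → <⇒≱ (lev-strict α∈A α≪β) levβ≤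

  complete-infimum-climbs : ∀ {α β β'} → A α → Δ₁ α β → Δ₂ α β' → lev β ≤ lev α → lev β' ≤ lev α → ⊥
  complete-infimum-climbs α∈A Δ₁β Δ₂β' levβ≤ levβ'≤ with lev-split α∈A Δ₁β Δ₂β'
  ... | inj₁ lt = <⇒≱ lt levβ≤
  ... | inj₂ lt = <⇒≱ lt levβ'≤

  fibre∩C-empty : ∀ {M α} → Fibre M α → ¬ Cset (Below M) α
  fibre∩C-empty (α∈A , refl) (_ , _ , _ , ((_ , levβ≤) , _) , ((_ , levβ'≤) , _) , inj₁ (Δ₁β , Δ₂β')) =
    complete-infimum-climbs α∈A Δ₁β Δ₂β' levβ≤ levβ'≤
  fibre∩C-empty (α∈A , refl) (_ , _ , _ , ((_ , levβ≤) , _) , ((_ , levβ'≤) , _) , inj₂ (Δ₂β , Δ₁β')) =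
    complete-infimum-climbs α∈A Δ₁β' Δ₂β levβ'≤ levβ≤

  Dset-Below⇔Fibre : ∀ {M α} → M ≤ top → Dset (Below M) α ⇔ Fibre M α
  Dset-Below⇔Fibre {M} {α} M≤top = mk⇔ on-level (λ f → fibre⊆B f , fibre∩C-empty f)
    where
      on-level : Dset (Below M) α → Fibre M α
      on-level (α∈B@((α∈A , lev≤M) , ¬above) , α∉C) with m≤n⇒m<n∨m≡n lev≤M
      ... | inj₂ lev≡M = α∈A , lev≡M
      ... | inj₁ lev<M with lev-fill α∈A lev<M M≤top
      ...   | inj₁ (β , β∈A , α≪β , levβ≤M) = ⊥-elim (¬above (β , (β∈A , levβ≤M) , α≪β))
      ...   | inj₂ (β , β' , β∈F , β'∈F , Δ₁β , Δ₂β') =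
                ⊥-elim (α∉C (α∈B , β , β' , fibre⊆B β∈F , fibre⊆B β'∈F , inj₁ (Δ₁β , Δ₂β')))

  Rem≐Below : ∀ j → Rem A j ≐ Below (top ∸ j)
  DD⇔Fibre : ∀ j {α} → DD A j α ⇔ Fibre (top ∸ j) α

  DD⇔Fibre j = ⇔-trans (Dset-cong (Rem≐Below j)) (Dset-Below⇔Fibre (m∸n≤m top j))

  Rem≐Below zero = (λ α∈A → α∈A , lev-≤top α∈A) , proj₁
  Rem≐Below (suc j) = peel , unpeel
    where
      IH = Rem≐Below j
      peel : Rem A (suc j) ⊆ Below (top ∸ suc j)
      peel {α} (α∈R , α∉D) = α∈A , subst (lev α ≤_) (pred[m∸n]≡m∸[1+n] top j) (<⇒≤pred lev<)
        where
          α∈A = proj₁ (proj₁ IH α∈R)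
          lev< : lev α < top ∸ j
          lev< = ≤∧≢⇒< (proj₂ (proj₁ IH α∈R)) (λ lev≡ → α∉D (from (DD⇔Fibre j) (α∈A , lev≡)))
      unpeel : Below (top ∸ suc j) ⊆ Rem A (suc j)
      unpeel {α} (α∈A , lev≤) = proj₂ IH (α∈A , ≤-trans lev≤ (∸-monoʳ-≤ top (n≤1+n j))) , α∉D
        where
          α∉D : ¬ DD A j α
          α∉D α∈D = <⇒≱ (∸-monoʳ-< {top} {suc j} {j} ≤-refl j<top) (subst (_≤ top ∸ suc j) lev≡ lev≤)
            where
              lev≡ = proj₂ (to (DD⇔Fibre j) α∈D)
              j<top = m∸n≢0⇒n<m (m<n⇒n≢0 (subst (1 ≤_) lev≡ (lev-pos α)))

  fibre⇒DD : ∀ {k α} → Fibre k α → DD A (top ∸ k) α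
  fibre⇒DD {α = α} (α∈A , refl) = from (DD⇔Fibre (top ∸ lev α)) (α∈A , sym (m∸[m∸n]≡n (lev-≤top α∈A)))

  Level⇔Fibre : ∀ {k α} → Level A top k α ⇔ Fibre k α
  Level⇔Fibre {k} {α} = mk⇔ off-level on-level
    where
      off-level : Level A top k α → Fibre k α
      off-level (_ , k≤top , α∈D) = subst (λ m → Fibre m α) (m∸[m∸n]≡n k≤top) (to (DD⇔Fibre (top ∸ k)) α∈D)
      on-level : Fibre k α → Level A top k α
      on-level α∈F@(α∈A , refl) = lev-pos α , lev-≤top α∈A , fibre⇒DD α∈F

  module _ (bottom : ∃ (Fibre 1)) where

    levelCount : IsLevelCount A top
    levelCount = cover , 1≤top , proj₁ bottom , fibre⇒DD (proj₂ bottom)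
      where
        1≤top : 1 ≤ top
        1≤top = subst (_≤ top) (proj₂ (proj₂ bottom)) (lev-≤top (proj₁ (proj₂ bottom)))
        cover : ∀ α → A α → ∃ λ j → (j < top) × DD A j α
        cover α α∈A = top ∸ lev α , ∸-monoʳ-< (lev-pos α) (lev-≤top α∈A) , fibre⇒DD (α∈A , refl)

    levelCount-unique : ∀ {N} → IsLevelCount A N → N ≡ top
    levelCount-unique {suc n} (cover , _ , α , α∈D) = ≤-antisym ≤top top≤
      where
        ≤top : suc n ≤ top
        ≤top = m∸n≢0⇒n<m (m<n⇒n≢0 (subst (1 ≤_) (proj₂ (to (DD⇔Fibre n) α∈D)) (lev-pos α)))
        top≤ : top ≤ suc n
        top≤ with cover (proj₁ bottom) (proj₁ (proj₂ bottom))
        ... | j , j<N , β∈D = ≤-trans (m∸n≡0⇒m≤n top∸sj≡0) j<N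
          where
            top∸j≡1 : top ∸ j ≡ 1
            top∸j≡1 = trans (sym (proj₂ (to (DD⇔Fibre j) β∈D))) (proj₂ (proj₂ bottom))
            top∸sj≡0 : top ∸ suc j ≡ 0
            top∸sj≡0 = trans (sym (pred[m∸n]≡m∸[1+n] top j)) (cong pred top∸j≡1)

    levels-are-fibres : (∃ λ N → IsLevelCount A N) ×
                        (∀ N → IsLevelCount A N → ∀ k α → Level A N k α ⇔ Fibre k α)
    levels-are-fibres = (top , levelCount) ,
      λ N N-count k α → subst (λ n → Level A n k α ⇔ Fibre k α) (sym (levelCount-unique N-count)) Level⇔Fibre

-- Deciding Ap(S₁, w₁) is what turns "(a , b) ∉ ω + S" into a choice of Apéry coordinate.
Ap₂-⊗ : ∀ {S₁ S₂ w₁ w₂ a b} → Dec (Ap₁ S₁ w₁ a) →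
        Ap₂ (S₁ ⊗ S₂) (w₁ , w₂) (a , b) ⇔ ((S₁ ⊗ S₂) (a , b) × (Ap₁ S₁ w₁ a ⊎ Ap₁ S₂ w₂ b))
Ap₂-⊗ {S₁} {S₂} {w₁} {w₂} {a} {b} a∈Ap? = mk⇔ split join
  where
    split : Ap₂ (S₁ ⊗ S₂) (w₁ , w₂) (a , b) → (S₁ ⊗ S₂) (a , b) × (Ap₁ S₁ w₁ a ⊎ Ap₁ S₂ w₂ b)
    split (ab∈S , ¬shift) = ab∈S , choose a∈Ap?
      where
        choose : Dec (Ap₁ S₁ w₁ a) → Ap₁ S₁ w₁ a ⊎ Ap₁ S₂ w₂ b
        choose (yes a∈Ap) = inj₁ a∈Ap
        choose (no a∉Ap)  = inj₂ (proj₂ ab∈S , λ (z , z∈S₂ , b≡) →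
          a∉Ap (proj₁ ab∈S , λ (y , y∈S₁ , a≡) → ¬shift ((y , z) , (y∈S₁ , z∈S₂) , cong₂ _,_ a≡ b≡)))
    join : (S₁ ⊗ S₂) (a , b) × (Ap₁ S₁ w₁ a ⊎ Ap₁ S₂ w₂ b) → Ap₂ (S₁ ⊗ S₂) (w₁ , w₂) (a , b)
    join (ab∈S , inj₁ (_ , ¬shift₁)) =
      ab∈S , λ ((y , _) , (y∈S₁ , _) , ab≡) → ¬shift₁ (y , y∈S₁ , cong proj₁ ab≡)
    join (ab∈S , inj₂ (_ , ¬shift₂)) =
      ab∈S , λ ((_ , z) , (_ , z∈S₂) , ab≡) → ¬shift₂ (z , z∈S₂ , cong proj₂ ab≡)

module ProductLevels (S₁ S₂ : Pred₁) (S₁-ns : IsNumericalSemigroup S₁) (S₂-ns : IsNumericalSemigroup S₂)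
    {w₁ w₂ : ℕ} (w₁∈S₁ : S₁ w₁) (w₂∈S₂ : S₂ w₂) (0<w₁ : 0 < w₁) (0<w₂ : 0 < w₂)
    (u v : ℕ → ℕ) (u-enum : Enumerates (Ap₁ S₁ w₁) w₁ u) (v-enum : Enumerates (Ap₁ S₂ w₂) w₂ v) where

  module U = ApéryRank S₁ S₁-ns 0<w₁ w₁∈S₁ u u-enum
  module V = ApéryRank S₂ S₂-ns 0<w₂ w₂∈S₂ v v-enum

  A : Pred₂
  A = Ap₂ (S₁ ⊗ S₂) (w₁ , w₂)

  ∈A⇔ : ∀ {a b} → A (a , b) ⇔ ((S₁ ⊗ S₂) (a , b) × (U.Image a ⊎ V.Image b))
  ∈A⇔ {a} = mk⇔ (λ α∈A → let (ab∈S , ap) = to (Ap₂-⊗ (U.ap? a)) α∈A in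
                           ab∈S , Sum.map (from U.image⇔ap) (from V.image⇔ap) ap)
                (λ (ab∈S , im) → from (Ap₂-⊗ (U.ap? a)) (ab∈S , Sum.map (to U.image⇔ap) (to V.image⇔ap) im))

  lev : ℕ² → ℕ
  lev (a , b) = suc (U.rank a + V.rank b)

  top : ℕ
  top = w₁ + w₂

  lev-≤top : ∀ {α} → A α → lev α ≤ top
  lev-≤top {a , b} α∈A with proj₂ (to ∈A⇔ α∈A)
  ... | inj₁ a-im = +-mono-≤ (proj₁ (U.image⇒index a-im)) (V.rank-≤ b)
  ... | inj₂ b-im = subst (_≤ top) (+-suc (U.rank a) (V.rank b))
                           (+-mono-≤ (U.rank-≤ a) (proj₁ (V.image⇒index b-im)))

  lev-climbs₁ : ∀ {a a' b b'} → U.Image a → a < a' → b ≤ b' → lev (a , b) < lev (a' , b')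
  lev-climbs₁ a-im a<a' b≤b' = s≤s (+-mono-≤ (U.image⇒suc-rank≤ a-im a<a') (V.rank-mono b≤b'))

  lev-climbs₂ : ∀ {a a' b b'} → V.Image b → a ≤ a' → b < b' → lev (a , b) < lev (a' , b')
  lev-climbs₂ {a} {a'} {b} {b'} b-im a≤a' b<b' =
    s≤s (subst (_≤ U.rank a' + V.rank b') (+-suc (U.rank a) (V.rank b))
               (+-mono-≤ (U.rank-mono a≤a') (V.image⇒suc-rank≤ b-im b<b')))

  lev-strict : ∀ {α β} → A α → α ≪ β → lev α < lev β
  lev-strict α∈A (a<a' , b<b') with proj₂ (to ∈A⇔ α∈A)
  ... | inj₁ a-im = lev-climbs₁ a-im a<a' (<⇒≤ b<b')
  ... | inj₂ b-im = lev-climbs₂ b-im (<⇒≤ a<a') b<b'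

  lev-split : ∀ {α β β'} → A α → Δ₁ α β → Δ₂ α β' → lev α < lev β ⊎ lev α < lev β'
  lev-split α∈A (refl , b<b') (refl , a<a') with proj₂ (to ∈A⇔ α∈A)
  ... | inj₁ a-im = inj₂ (lev-climbs₁ a-im a<a' ≤-refl)
  ... | inj₂ b-im = inj₁ (lev-climbs₂ b-im ≤-refl b<b')

  lev-cong : ∀ {a a' b b'} → U.rank a' ≡ U.rank a → V.rank b' ≡ V.rank b → lev (a' , b') ≡ lev (a , b)
  lev-cong ra≡ rb≡ = cong suc (cong₂ _+_ ra≡ rb≡)

  lev-suc₁ : ∀ {a a' b} → U.rank a' ≡ suc (U.rank a) → lev (a' , b) ≡ suc (lev (a , b))
  lev-suc₁ {b = b} ra≡ = cong (λ r → suc (r + V.rank b)) ra≡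

  lev-suc₂ : ∀ {a b b'} → V.rank b' ≡ suc (V.rank b) → lev (a , b') ≡ suc (lev (a , b))
  lev-suc₂ {a} {b} rb≡ = trans (cong (λ r → suc (U.rank a + r)) rb≡) (cong suc (+-suc (U.rank a) (V.rank b)))

  image-or-top : ∀ {a b} → (U.Image a ⊎ U.rank a ≡ w₁) → (V.Image b ⊎ V.rank b ≡ w₂) →
                 lev (a , b) ≤ top → U.Image a ⊎ V.Image b
  image-or-top (inj₁ a-im) _            _     = inj₁ a-im
  image-or-top (inj₂ _)    (inj₁ b-im)  _     = inj₂ b-im
  image-or-top (inj₂ ra≡)  (inj₂ rb≡)   lev≤ =
    ⊥-elim (1+n≰n (subst (_≤ top) (cong suc (cong₂ _+_ ra≡ rb≡)) lev≤))

  -- Move both coordinates to their next elements; if that overshoots M, both coordinates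
  -- are Apéry elements and moving only one of them lands exactly on level M.
  lev-fill : ∀ {α M} → A α → lev α < M → M ≤ top →
     (∃ λ β → A β × α ≪ β × lev β ≤ M) ⊎
     (∃ λ β → ∃ λ β' → (A β × lev β ≡ M) × (A β' × lev β' ≡ M) × Δ₁ α β × Δ₂ α β')
  lev-fill {a , b} {M} α∈A lev<M M≤top with proj₁ (to ∈A⇔ α∈A)
  ... | a∈S , b∈S with U.next-element a∈S | V.next-element b∈S
  ... | a⁺ , a⁺∈S , a<a⁺ , a⁺-ok , ra⁺ | b⁺ , b⁺∈S , b<b⁺ , b⁺-ok , rb⁺ with lev (a⁺ , b⁺) ≤? M
  ... | yes lev⁺≤M = inj₁ ((a⁺ , b⁺) , α⁺∈A , (a<a⁺ , b<b⁺) , lev⁺≤M)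
    where α⁺∈A = from ∈A⇔ ((a⁺∈S , b⁺∈S) , image-or-top a⁺-ok b⁺-ok (≤-trans lev⁺≤M M≤top))
  ... | no lev⁺≰M = inj₂ (corner (U.rank-suc a) (V.rank-suc b))
    where
      overshoots : ¬ lev (a⁺ , b⁺) ≤ suc (lev (a , b))
      overshoots le = lev⁺≰M (≤-trans le lev<M)
      corner : U.rank (suc a) ≡ U.rank a ⊎ (U.Image a × U.rank (suc a) ≡ suc (U.rank a)) →
               V.rank (suc b) ≡ V.rank b ⊎ (V.Image b × V.rank (suc b) ≡ suc (V.rank b)) →
               ∃ λ β → ∃ λ β' → (A β × lev β ≡ M) × (A β' × lev β' ≡ M) × Δ₁ (a , b) β × Δ₂ (a , b) β'
      corner (inj₁ ra≡) (inj₁ rb≡) =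
        ⊥-elim (overshoots (≤-trans (≤-reflexive (lev-cong (trans ra⁺ ra≡) (trans rb⁺ rb≡))) (n≤1+n _)))
      corner (inj₁ ra≡) (inj₂ (_ , rb≡)) =
        ⊥-elim (overshoots (≤-reflexive (trans (lev-cong (trans ra⁺ ra≡) refl) (lev-suc₂ (trans rb⁺ rb≡)))))
      corner (inj₂ (_ , ra≡)) (inj₁ rb≡) =
        ⊥-elim (overshoots (≤-reflexive (trans (lev-cong refl (trans rb⁺ rb≡)) (lev-suc₁ (trans ra⁺ ra≡)))))
      corner (inj₂ (a-im , ra≡)) (inj₂ (b-im , rb≡)) =
        (a , b⁺) , (a⁺ , b) ,
        (from ∈A⇔ ((a∈S , b⁺∈S) , inj₁ a-im) , trans (lev-suc₂ (trans rb⁺ rb≡)) next-level) ,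
        (from ∈A⇔ ((a⁺∈S , b∈S) , inj₂ b-im) , trans (lev-suc₁ (trans ra⁺ ra≡)) next-level) ,
        (refl , b<b⁺) , (refl , a<a⁺)
        where
          lev⁺≡ : lev (a⁺ , b⁺) ≡ suc (suc (lev (a , b)))
          lev⁺≡ = trans (lev-suc₁ (trans ra⁺ ra≡)) (cong suc (lev-suc₂ (trans rb⁺ rb≡)))
          next-level : suc (lev (a , b)) ≡ M
          next-level = ≤-antisym lev<M (≤-pred (≰⇒> (λ le → lev⁺≰M (subst (_≤ M) (sym lev⁺≡) le))))

  open Levels A lev top (λ _ → s≤s z≤n) lev-≤top lev-strict lev-split lev-fill public

  fibre-1⇔ : ∀ {α} → Fibre 1 α ⇔ α ≡ (0 , 0)
  fibre-1⇔ {a , b} = mk⇔ origin (λ { refl → 0∈A , cong suc (cong₂ _+_ U.rank-0 V.rank-0) })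
    where
      0∈A : A (0 , 0)
      0∈A = from ∈A⇔ ((U.image⇒∈S U.image-0 , V.image⇒∈S V.image-0) , inj₁ U.image-0)
      origin : Fibre 1 (a , b) → (a , b) ≡ (0 , 0)
      origin (_ , lev≡1) = cong₂ _,_ (U.rank≡0⇒≡0 (m+n≡0⇒m≡0 _ ranks≡0)) (V.rank≡0⇒≡0 (m+n≡0⇒n≡0 _ ranks≡0))
        where ranks≡0 = suc-injective lev≡1

  rhs⇒fibre : ∀ {k α} → RHS S₁ S₂ w₁ w₂ u v k α → Fibre k α
  rhs⇒fibre (i , j , 1≤i , i≤w , 1≤j , j≤w , i+j≡k , inj₁ (refl , b∈S , slot)) =
    from ∈A⇔ ((U.image⇒∈S u-im , b∈S) , inj₁ u-im) ,
    trans (cong₂ _+_ (U.suc-rank-u 1≤i i≤w) (from (V.rank≡⇔ 1≤j j≤w) slot)) i+j≡k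
    where u-im = i , 1≤i , i≤w , refl
  rhs⇒fibre {α = a , _} (i , j , 1≤i , i≤w , 1≤j , j≤w , i+j≡k , inj₂ (refl , a∈S , slot)) =
    from ∈A⇔ ((a∈S , V.image⇒∈S v-im) , inj₂ v-im) ,
    trans (sym (+-suc (U.rank a) _))
          (trans (cong₂ _+_ (from (U.rank≡⇔ 1≤i i≤w) slot) (V.suc-rank-u 1≤j j≤w)) i+j≡k)
    where v-im = j , 1≤j , j≤w , refl

  image₁⇒rhs : ∀ {k a b} → 2 ≤ k → U.Image a → S₂ b → lev (a , b) ≡ k → RHS S₁ S₂ w₁ w₂ u v k (a , b)
  image₁⇒rhs {k} {b = b} 2≤k (i , 1≤i , i≤w , refl) b∈S lev≡k with V.rank b in rb≡
  ... | suc j = i , suc j , 1≤i , i≤w , s≤s z≤n , sj≤w , i+j≡k ,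
                inj₁ (refl , b∈S , to (V.rank≡⇔ (s≤s z≤n) sj≤w) rb≡)
    where
      sj≤w = subst (_≤ w₂) rb≡ (V.rank-≤ b)
      i+j≡k : i + suc j ≡ k
      i+j≡k = trans (cong (_+ suc j) (sym (U.suc-rank-u 1≤i i≤w))) lev≡k
  ... | zero = on-first-row i 1≤i i≤w
                 (trans (sym (U.suc-rank-u 1≤i i≤w)) (trans (cong suc (sym (+-identityʳ _))) lev≡k))
    where
      b≡v₁ : b ≡ v 1
      b≡v₁ = trans (V.rank≡0⇒≡0 rb≡) (sym V.u-1≡0)
      on-first-row : ∀ i → 1 ≤ i → i ≤ w₁ → i ≡ k → RHS S₁ S₂ w₁ w₂ u v k (u i , b)
      on-first-row (suc zero) _ _ refl = ⊥-elim (1+n≰n 2≤k)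
      on-first-row (suc (suc i)) _ i≤w refl =
        suc i , 1 , s≤s z≤n , <⇒≤ i≤w , s≤s z≤n , 0<w₂ , +-comm (suc i) 1 ,
        inj₂ (b≡v₁ , U.image⇒∈S (suc (suc i) , s≤s z≤n , i≤w , refl) ,
              proj₁ u-enum _ _ (s≤s z≤n) ≤-refl i≤w , λ _ → ≤-refl)

  image₂⇒rhs : ∀ {k a b} → ¬ U.Image a → S₁ a → V.Image b → lev (a , b) ≡ k → RHS S₁ S₂ w₁ w₂ u v k (a , b)
  image₂⇒rhs {k} {a} a∉im a∈S (j , 1≤j , j≤w , refl) lev≡k with U.rank a in ra≡
  ... | zero = ⊥-elim (a∉im (subst U.Image (sym (U.rank≡0⇒≡0 ra≡)) U.image-0))
  ... | suc i = suc i , j , s≤s z≤n , si≤w , 1≤j , j≤w , i+j≡k ,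
                inj₂ (refl , a∈S , to (U.rank≡⇔ (s≤s z≤n) si≤w) ra≡)
    where
      si≤w = subst (_≤ w₁) ra≡ (U.rank-≤ a)
      i+j≡k : suc i + j ≡ k
      i+j≡k = trans (cong (suc i +_) (sym (V.suc-rank-u 1≤j j≤w))) (trans (+-suc (suc i) _) lev≡k)

  fibre⇔rhs : ∀ {k α} → 2 ≤ k → Fibre k α ⇔ RHS S₁ S₂ w₁ w₂ u v k α
  fibre⇔rhs {k} {a , b} 2≤k = mk⇔ to-rhs rhs⇒fibre
    where
      to-rhs : Fibre k (a , b) → RHS S₁ S₂ w₁ w₂ u v k (a , b)
      to-rhs (α∈A , lev≡k) with to ∈A⇔ α∈A | U.image? a
      ... | (_ , b∈S) , _         | yes a-im = image₁⇒rhs 2≤k a-im b∈S lev≡k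
      ... | _         , inj₁ a-im | no a∉im  = ⊥-elim (a∉im a-im)
      ... | (a∈S , _) , inj₂ b-im | no a∉im  = image₂⇒rhs a∉im a∈S b-im lev≡k

corollary4p5 : (S₁ S₂ : ℕ → Set) → IsNumericalSemigroup S₁ → IsNumericalSemigroup S₂ →
    (w₁ w₂ : ℕ) → S₁ w₁ → S₂ w₂ → 0 < w₁ → 0 < w₂ →
    (u v : ℕ → ℕ) → Enumerates (Ap₁ S₁ w₁) w₁ u → Enumerates (Ap₁ S₂ w₂) w₂ v →
    (∃ λ N → IsLevelCount (Ap₂ (S₁ ⊗ S₂) (w₁ , w₂)) N) ×
    (∀ N → IsLevelCount (Ap₂ (S₁ ⊗ S₂) (w₁ , w₂)) N →
      (∀ α → Level (Ap₂ (S₁ ⊗ S₂) (w₁ , w₂)) N 1 α ⇔ (α ≡ (0 , 0))) ×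
      (∀ k → 2 ≤ k → ∀ α →
        Level (Ap₂ (S₁ ⊗ S₂) (w₁ , w₂)) N k α ⇔ RHS S₁ S₂ w₁ w₂ u v k α))
corollary4p5 S₁ S₂ S₁-ns S₂-ns w₁ w₂ w₁∈S₁ w₂∈S₂ 0<w₁ 0<w₂ u v u-enum v-enum =
  let count , levels = levels-are-fibres ((0 , 0) , from fibre-1⇔ refl) in
  count , λ N N-count →
    (λ α → ⇔-trans (levels N N-count 1 α) fibre-1⇔) ,
    (λ k 2≤k α → ⇔-trans (levels N N-count k α) (fibre⇔rhs 2≤k))
  where open ProductLevels S₁ S₂ S₁-ns S₂-ns w₁∈S₁ w₂∈S₂ 0<w₁ 0<w₂ u v u-enum v-enum
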